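{- Let $\mu\ge1$ and $m\ge1$ be integers. Then, as formal power series in $t$, $$\sum_{n=0}^\infty B_{n,\le m}^{(\mu)}\frac{t^n}{n!}=\frac{\mathrm{Li}_\mu\bigl(1-E_m(-t)\bigr)}{1-E_m(-t)} \quad\text{and}\quad \sum_{n=0}^\infty B_{n,\ge m}^{(\mu)}\frac{t^n}{n!}=\frac{\mathrm{Li}_\mu\bigl(E_{m-1}(-t)-e^{ -t}\bigr)}{E_{m-1}(-t)-e^{ -t}},$$ where for a power series $z$ with zero constant term, $\mathrm{Li}_\mu(z)/z$ means $\sum_{k\ge0} z^k/(k+1)^\mu$.
   Context: $E_m(t)=\sum_{k=0}^m \frac{t^k}{k!}$ (so $E_0(t)=1$). $\mathrm{Li}_\mu(z)=\sum_{j\ge1} z^j/j^\mu$ is the polylogarithm. For integers $n,k\ge0$, $m\ge1$, $\left\{ {n \atop k} \right\}_{\le m}$ (resp. $\left\{ {n \atop k} \right\}_{\ge m}$) is the number of partitions of an $n$-element set into $k$ nonempty blocks each of size at most $m$ (resp. at least $m$), with the value $1$ for $n=k=0$. The restricted and associated poly-Bernoulli numbers are $$B_{n,\le m}^{(\mu)}=\sum_{k=0}^n(-1)^{n-k}\frac{k!}{(k+1)^\mu}\left\{ {n \atop k} \right\}_{\le m},\qquad B_{n,\ge m}^{(\mu)}=\sum_{k=0}^n(-1)^{n-k}\frac{k!}{(k+1)^\mu}\left\{ {n \atop k} \right\}_{\ge m}\qquad(n\ge0).$$ -}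

module Defs where

open import Data.Nat as ℕ using (ℕ; zero; suc; _≤?_; _≡ᵇ_; _<ᵇ_)
open import Data.Nat.Properties using (_!≢0; m^n≢0)
open import Data.Bool using (Bool; true; false; _∧_; if_then_else_)
open import Data.Fin using (Fin; toℕ)
open import Data.Vec using (Vec; []; _∷_)
open import Data.List using (List; []; _∷_; concatMap; map; allFin)
open import Data.Integer using (ℤ; +_; -[1+_])
open import Data.Rational using (ℚ; 0ℚ; 1ℚ; _+_; _*_; _-_; -_; _/_)
open import Relation.Nullary.Decidable using (does)

-- Set partitions, encoded by restricted growth strings.
-- A partition of {0,…,n-1} into k nonempty blocks corresponds bijectively
-- to its canonical labelling f : {0,…,n-1} → Fin k, where blocks are
-- numbered 0,1,…,k-1 in increasing order of their least element.
-- Such labellings are exactly the words x₀…x_{n-1} over Fin k with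
-- x_i ≤ max(x₀,…,x_{i-1}) + 1 (x₀ = 0) using every label.

words : (k n : ℕ) → List (Vec (Fin k) n)
words k zero    = [] ∷ []
words k (suc n) = concatMap (λ x → map (x ∷_) (words k n)) (allFin k)

-- scan with c = number of labels used so far
canonicalFrom : ∀ {k n} → ℕ → Vec (Fin k) n → Bool
canonicalFrom {k} c []       = c ≡ᵇ k
canonicalFrom c (x ∷ xs) with toℕ x ≡ᵇ c
... | true  = canonicalFrom (suc c) xs
... | false = (toℕ x <ᵇ c) ∧ canonicalFrom c xs

canonical : ∀ {k n} → Vec (Fin k) n → Bool
canonical = canonicalFrom 0

blockSize : ∀ {k n} → Fin k → Vec (Fin k) n → ℕ
blockSize j []       = 0
blockSize j (x ∷ xs) = (if toℕ x ≡ᵇ toℕ j then 1 else 0) ℕ.+ blockSize j xs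

countᵇ : ∀ {A : Set} → (A → Bool) → List A → ℕ
countᵇ P []       = 0
countᵇ P (x ∷ xs) = (if P x then 1 else 0) ℕ.+ countᵇ P xs

allᵇ : ∀ {A : Set} → (A → Bool) → List A → Bool
allᵇ P []       = true
allᵇ P (x ∷ xs) = P x ∧ allᵇ P xs

allBlocks : ∀ {k n} → (ℕ → Bool) → Vec (Fin k) n → Bool
allBlocks {k} P w = allᵇ (λ j → P (blockSize j w)) (allFin k)

S≤ : (m n k : ℕ) → ℕ
S≤ m n k = countᵇ (λ w → canonical w ∧ allBlocks (λ s → s ℕ.≤ᵇ m) w) (words k n)

S≥ : (m n k : ℕ) → ℕ
S≥ m n k = countᵇ (λ w → canonical w ∧ allBlocks (λ s → m ℕ.≤ᵇ s) w) (words k n)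

sgn : ℕ → ℚ
sgn zero    = 1ℚ
sgn (suc j) = - sgn j

invFact : ℕ → ℚ
invFact j = (+ 1 / (j ℕ.!)) {{j !≢0}}

invPow : ℕ → ℕ → ℚ
invPow k μ = (+ 1 / (suc k ℕ.^ μ)) {{m^n≢0 (suc k) μ}}

Σ≤ : ℕ → (ℕ → ℚ) → ℚ
Σ≤ zero    f = f 0
Σ≤ (suc n) f = Σ≤ n f + f (suc n)

polyB : (ℕ → ℕ → ℕ) → ℕ → ℕ → ℚ
polyB S μ n = Σ≤ n (λ k → sgn (n ℕ.∸ k) * ((+ (k ℕ.! ℕ.* S n k) / 1) * invPow k μ))

B≤ : (μ m n : ℕ) → ℚ
B≤ μ m n = polyB (S≤ m) μ n

B≥ : (μ m n : ℕ) → ℚ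
B≥ μ m n = polyB (S≥ m) μ n

Series : Set
Series = ℕ → ℚ

oneS : Series
oneS zero    = 1ℚ
oneS (suc _) = 0ℚ

_⊝_ : Series → Series → Series
(f ⊝ g) n = f n - g n

_⊛_ : Series → Series → Series
(f ⊛ g) n = Σ≤ n (λ i → f i * g (n ℕ.∸ i))

_^S_ : Series → ℕ → Series
z ^S zero    = oneS
z ^S suc k   = z ⊛ (z ^S k)

negArg : Series → Series
negArg f j = sgn j * f j

expS : Series
expS j = invFact j

E : ℕ → Series
E m j = if does (j ≤? m) then invFact j else 0ℚ

egf : (ℕ → ℚ) → Series
egf a n = a n * invFact n

-- Li_μ(z)/z := Σ_{k≥0} z^k/(k+1)^μ, for z with zero constant term.
-- Since z^k has no terms of degree < k, the coefficient of t^n only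
-- involves k ≤ n, so the sum below is the exact coefficient.
LiOver : ℕ → Series → Series
LiOver μ z n = Σ≤ n (λ k → (z ^S k) n * invPow k μ)

-- For a set P of admissible block sizes put y(t) = Σ_{b ≥ 1, b ∈ P} tᵇ/b!. The number of
-- partitions of an n-set into k blocks with sizes in P is n! [tⁿ] yᵏ/k!, so with z(t) = -y(-t)
-- one gets (-1)ⁿ⁻ᵏ k! S(n,k)/n! = [tⁿ] zᵏ, which is the coefficient identity behind both
-- formulas: -y(-t) is 1 - E_m(-t) for sizes ≤ m and E_{m-1}(-t) - e⁻ᵗ for sizes ≥ m.
--
-- A prefix that
-- has opened c blocks, of current sizes s₀,…,s_{c-1}, has n! [tⁿ] f_{s₀}⋯f_{s_{c-1}} y^{k-c}/(k-c)!
-- completions of length n, where f_s(t) = Σ_{s+b ∈ P} tᵇ/b!. The next letter either enlarges an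
-- open block or opens the next one, and this is mirrored by the Leibniz rule for the derivative
-- of the product, since f_s' = f_{s+1} and y' = f_1.

module Submission where

open import Defs
open import Data.Bool using (Bool; true; false; if_then_else_; _∧_)
open import Data.Bool.Properties using (T-≡; ¬-not)
open import Data.Fin using (Fin; toℕ)
import Data.Integer as ℤ
import Data.Integer.Properties as ℤₚ
open import Data.List using (List; []; _∷_; _++_; map; concatMap; allFin)
import Data.List.Properties as List
import Data.Nat as ℕ
open import Data.Nat using (ℕ; zero; suc; _≤_; _<_; _∸_; _!; _≡ᵇ_; _<ᵇ_; _≤ᵇ_; z≤n; s≤s; NonZero)
import Data.Nat.Coprimality as Coprime
open import Data.Nat.ListAction using (sum)
import Data.Nat.Properties as ℕₚ
open import Data.Product using (_×_; _,_)
open import Data.Rational using (ℚ; mkℚ; 0ℚ; 1ℚ; _+_; _*_; -_; _/_; toℚᵘ)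
import Data.Rational.Properties as ℚₚ
open import Data.Rational.Solver using (module +-*-Solver)
import Data.Rational.Unnormalised as ℚᵘ
import Data.Rational.Unnormalised.Properties as ℚᵘₚ
open import Data.Sum using (inj₁; inj₂)
open import Data.Vec using (Vec; []; _∷_)
open import Function.Bundles using (Equivalence)
open import Relation.Binary.PropositionalEquality
open +-*-Solver

fromℕ : ℕ → ℚ
fromℕ a = ℤ.+ a / 1

fromℕ≡mkℚ : ∀ a → fromℕ a ≡ mkℚ (ℤ.+ a) 0 (Coprime.sym (Coprime.1-coprimeTo a))
fromℕ≡mkℚ a = ℚₚ.normalize-coprime (Coprime.sym (Coprime.1-coprimeTo a))

fromℕ-+ : ∀ a b → fromℕ (a ℕ.+ b) ≡ fromℕ a + fromℕ b
fromℕ-+ a b = ℚₚ.toℚᵘ-injective (ℚᵘₚ.≃-trans unnormalised (ℚᵘₚ.≃-sym (ℚₚ.toℚᵘ-homo-+ (fromℕ a) (fromℕ b))))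
  where
  unnormalised : toℚᵘ (fromℕ (a ℕ.+ b)) ℚᵘ.≃ (toℚᵘ (fromℕ a) ℚᵘ.+ toℚᵘ (fromℕ b))
  unnormalised rewrite fromℕ≡mkℚ (a ℕ.+ b) | fromℕ≡mkℚ a | fromℕ≡mkℚ b =
    ℚᵘ.*≡* (cong (ℤ._* ℤ.+ 1) (trans (ℤₚ.pos-+ a b)
      (sym (cong₂ ℤ._+_ (ℤₚ.*-identityʳ (ℤ.+ a)) (ℤₚ.*-identityʳ (ℤ.+ b))))))

fromℕ-* : ∀ a b → fromℕ (a ℕ.* b) ≡ fromℕ a * fromℕ b
fromℕ-* a b = ℚₚ.toℚᵘ-injective (ℚᵘₚ.≃-trans unnormalised (ℚᵘₚ.≃-sym (ℚₚ.toℚᵘ-homo-* (fromℕ a) (fromℕ b))))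
  where
  unnormalised : toℚᵘ (fromℕ (a ℕ.* b)) ℚᵘ.≃ (toℚᵘ (fromℕ a) ℚᵘ.* toℚᵘ (fromℕ b))
  unnormalised rewrite fromℕ≡mkℚ (a ℕ.* b) | fromℕ≡mkℚ a | fromℕ≡mkℚ b =
    ℚᵘ.*≡* (cong (ℤ._* ℤ.+ 1) (ℤₚ.pos-* a b))

fromℕ-*-inverse : ∀ d .{{_ : NonZero d}} → fromℕ d * (ℤ.+ 1 / d) ≡ 1ℚ
fromℕ-*-inverse (suc d) =
  trans (cong₂ _*_ (fromℕ≡mkℚ (suc d)) (ℚₚ.normalize-coprime (Coprime.1-coprimeTo (suc d))))
        (ℚₚ.*-inverseʳ (mkℚ (ℤ.+ suc d) 0 (Coprime.sym (Coprime.1-coprimeTo (suc d)))))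

n!*invFact≡1 : ∀ n → fromℕ (n !) * invFact n ≡ 1ℚ
n!*invFact≡1 n = fromℕ-*-inverse (n !) {{n ℕₚ.!≢0}}

suc*invFact-suc : ∀ n → fromℕ (suc n) * invFact (suc n) ≡ invFact n
suc*invFact-suc n = begin
  fromℕ (suc n) * invFact (suc n)
    ≡⟨ ℚₚ.*-identityʳ _ ⟨
  fromℕ (suc n) * invFact (suc n) * 1ℚ
    ≡⟨ cong (fromℕ (suc n) * invFact (suc n) *_) (n!*invFact≡1 n) ⟨
  fromℕ (suc n) * invFact (suc n) * (fromℕ (n !) * invFact n)
    ≡⟨ solve 4 (λ a b d c → a :* b :* (d :* c) := a :* d :* b :* c) refl
         (fromℕ (suc n)) (invFact (suc n)) (fromℕ (n !)) (invFact n) ⟩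
  fromℕ (suc n) * fromℕ (n !) * invFact (suc n) * invFact n
    ≡⟨ cong (λ x → x * invFact (suc n) * invFact n) (fromℕ-* (suc n) (n !)) ⟨
  fromℕ (suc n !) * invFact (suc n) * invFact n
    ≡⟨ cong (_* invFact n) (n!*invFact≡1 (suc n)) ⟩
  1ℚ * invFact n
    ≡⟨ ℚₚ.*-identityˡ (invFact n) ⟩
  invFact n ∎
  where open ≡-Reasoning

-- Finite sums

Σ≤-cong : ∀ n {f g : ℕ → ℚ} → (∀ i → i ≤ n → f i ≡ g i) → Σ≤ n f ≡ Σ≤ n g
Σ≤-cong zero    f≗g = f≗g 0 z≤n
Σ≤-cong (suc n) f≗g = cong₂ _+_ (Σ≤-cong n (λ i i≤n → f≗g i (ℕₚ.m≤n⇒m≤1+n i≤n))) (f≗g (suc n) ℕₚ.≤-refl)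

Σ≤-0 : ∀ n {f : ℕ → ℚ} → (∀ i → i ≤ n → f i ≡ 0ℚ) → Σ≤ n f ≡ 0ℚ
Σ≤-0 n f≗0 = trans (Σ≤-cong n f≗0) (Σ≤-const0 n)
  where
  Σ≤-const0 : ∀ n → Σ≤ n (λ _ → 0ℚ) ≡ 0ℚ
  Σ≤-const0 zero    = refl
  Σ≤-const0 (suc n) = cong (_+ 0ℚ) (Σ≤-const0 n)

Σ≤-+ : ∀ n (f g : ℕ → ℚ) → Σ≤ n (λ i → f i + g i) ≡ Σ≤ n f + Σ≤ n g
Σ≤-+ zero    f g = refl
Σ≤-+ (suc n) f g = trans (cong (_+ (f (suc n) + g (suc n))) (Σ≤-+ n f g))
  (solve 4 (λ a b c d → (a :+ b) :+ (c :+ d) := (a :+ c) :+ (b :+ d)) refl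
     (Σ≤ n f) (Σ≤ n g) (f (suc n)) (g (suc n)))

*-distribˡ-Σ≤ : ∀ n c (f : ℕ → ℚ) → c * Σ≤ n f ≡ Σ≤ n (λ i → c * f i)
*-distribˡ-Σ≤ zero    c f = refl
*-distribˡ-Σ≤ (suc n) c f =
  trans (ℚₚ.*-distribˡ-+ c (Σ≤ n f) (f (suc n))) (cong (_+ c * f (suc n)) (*-distribˡ-Σ≤ n c f))

*-distribʳ-Σ≤ : ∀ n c (f : ℕ → ℚ) → Σ≤ n f * c ≡ Σ≤ n (λ i → f i * c)
*-distribʳ-Σ≤ n c f =
  trans (ℚₚ.*-comm _ c) (trans (*-distribˡ-Σ≤ n c f) (Σ≤-cong n (λ i _ → ℚₚ.*-comm c (f i))))

Σ≤-suc-head : ∀ n (f : ℕ → ℚ) → Σ≤ (suc n) f ≡ f 0 + Σ≤ n (λ i → f (suc i))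
Σ≤-suc-head zero    f = refl
Σ≤-suc-head (suc n) f =
  trans (cong (_+ f (suc (suc n))) (Σ≤-suc-head n f)) (ℚₚ.+-assoc (f 0) _ (f (suc (suc n))))

Σ≤-reverse : ∀ n (f : ℕ → ℚ) → Σ≤ n f ≡ Σ≤ n (λ i → f (n ∸ i))
Σ≤-reverse zero    f = refl
Σ≤-reverse (suc n) f = sym (begin
  Σ≤ (suc n) (λ i → f (suc n ∸ i))            ≡⟨ Σ≤-suc-head n (λ i → f (suc n ∸ i)) ⟩
  f (suc n) + Σ≤ n (λ i → f (n ∸ i))          ≡⟨ cong (f (suc n) +_) (Σ≤-reverse n f) ⟨
  f (suc n) + Σ≤ n f                          ≡⟨ ℚₚ.+-comm (f (suc n)) (Σ≤ n f) ⟩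
  Σ≤ (suc n) f                                ∎)
  where open ≡-Reasoning

Σ≤-exchange : ∀ n (F : ℕ → ℕ → ℚ) →
  Σ≤ n (λ i → Σ≤ i (λ a → F a i)) ≡ Σ≤ n (λ a → Σ≤ (n ∸ a) (λ b → F a (a ℕ.+ b)))
Σ≤-exchange zero    F = refl
Σ≤-exchange (suc n) F = begin
  Σ≤ n (λ i → Σ≤ i (λ a → F a i)) + (Σ≤ n (λ a → F a (suc n)) + F (suc n) (suc n))
    ≡⟨ cong (_+ (Σ≤ n (λ a → F a (suc n)) + F (suc n) (suc n))) (Σ≤-exchange n F) ⟩
  Columns n + (Σ≤ n (λ a → F a (suc n)) + F (suc n) (suc n))
    ≡⟨ ℚₚ.+-assoc (Columns n) _ _ ⟨
  Columns n + Σ≤ n (λ a → F a (suc n)) + F (suc n) (suc n)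
    ≡⟨ cong₂ _+_ (Σ≤-+ n _ _) (cong (F (suc n)) (ℕₚ.+-identityʳ (suc n))) ⟨
  Σ≤ n (λ a → Σ≤ (n ∸ a) (λ b → F a (a ℕ.+ b)) + F a (suc n)) + F (suc n) (suc n ℕ.+ 0)
    ≡⟨ cong₂ _+_ (Σ≤-cong n extendColumn)
         (cong (λ x → Σ≤ x (λ b → F (suc n) (suc n ℕ.+ b))) (sym (ℕₚ.n∸n≡0 n))) ⟩
  Σ≤ n (λ a → Σ≤ (suc n ∸ a) (λ b → F a (a ℕ.+ b))) + Σ≤ (suc n ∸ suc n) (λ b → F (suc n) (suc n ℕ.+ b)) ∎
  where
  open ≡-Reasoning
  Columns : ℕ → ℚ
  Columns n = Σ≤ n (λ a → Σ≤ (n ∸ a) (λ b → F a (a ℕ.+ b)))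
  extendColumn : ∀ a → a ≤ n →
    Σ≤ (n ∸ a) (λ b → F a (a ℕ.+ b)) + F a (suc n) ≡ Σ≤ (suc n ∸ a) (λ b → F a (a ℕ.+ b))
  extendColumn a a≤n rewrite ℕₚ.+-∸-assoc 1 a≤n =
    cong (λ x → Σ≤ (n ∸ a) (λ b → F a (a ℕ.+ b)) + F a x)
      (sym (trans (ℕₚ.+-suc a (n ∸ a)) (cong suc (ℕₚ.m+[n∸m]≡n a≤n))))

Σ< : ℕ → (ℕ → ℚ) → ℚ
Σ< zero    g = 0ℚ
Σ< (suc c) g = g 0 + Σ< c (λ j → g (suc j))

Σ<-cong : ∀ c {f g : ℕ → ℚ} → (∀ j → j < c → f j ≡ g j) → Σ< c f ≡ Σ< c g
Σ<-cong zero    f≗g = refl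
Σ<-cong (suc c) f≗g = cong₂ _+_ (f≗g 0 (s≤s z≤n)) (Σ<-cong c (λ j j<c → f≗g (suc j) (s≤s j<c)))

Σ<-0 : ∀ c {g : ℕ → ℚ} → (∀ j → j < c → g j ≡ 0ℚ) → Σ< c g ≡ 0ℚ
Σ<-0 zero    g≗0 = refl
Σ<-0 (suc c) g≗0 = cong₂ _+_ (g≗0 0 (s≤s z≤n)) (Σ<-0 c (λ j j<c → g≗0 (suc j) (s≤s j<c)))

*-distribˡ-Σ< : ∀ c x (g : ℕ → ℚ) → x * Σ< c g ≡ Σ< c (λ j → x * g j)
*-distribˡ-Σ< zero    x g = ℚₚ.*-zeroʳ x
*-distribˡ-Σ< (suc c) x g = trans (ℚₚ.*-distribˡ-+ x (g 0) _) (cong (x * g 0 +_) (*-distribˡ-Σ< c x _))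

Σ<-suc-last : ∀ c (g : ℕ → ℚ) → Σ< (suc c) g ≡ Σ< c g + g c
Σ<-suc-last zero    g = trans (ℚₚ.+-identityʳ (g 0)) (sym (ℚₚ.+-identityˡ (g 0)))
Σ<-suc-last (suc c) g =
  trans (cong (g 0 +_) (Σ<-suc-last c (λ j → g (suc j)))) (sym (ℚₚ.+-assoc (g 0) _ (g (suc c))))

Σ<-truncate : ∀ c k (g : ℕ → ℚ) → c ≤ k → (∀ j → c ≤ j → j < k → g j ≡ 0ℚ) → Σ< k g ≡ Σ< c g
Σ<-truncate zero    k       g _           g≗0 = Σ<-0 k (λ j → g≗0 j z≤n)
Σ<-truncate (suc c) (suc k) g (s≤s c≤k) g≗0 =
  cong (g 0 +_) (Σ<-truncate c k _ c≤k (λ j c≤j j<k → g≗0 (suc j) (s≤s c≤j) (s≤s j<k)))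

-- Formal power series

infix 4 _≈_
_≈_ : Series → Series → Set
f ≈ g = ∀ n → f n ≡ g n

≈-trans : ∀ {f g h} → f ≈ g → g ≈ h → f ≈ h
≈-trans f≈g g≈h n = trans (f≈g n) (g≈h n)

≈-sym : ∀ {f g} → f ≈ g → g ≈ f
≈-sym f≈g n = sym (f≈g n)

0S : Series
0S _ = 0ℚ

_⊕_ : Series → Series → Series
(f ⊕ g) n = f n + g n

_·S_ : ℚ → Series → Series
(x ·S f) n = x * f n

ΣS< : ℕ → (ℕ → Series) → Series
ΣS< c G n = Σ< c (λ j → G j n)

D : Series → Series
D f n = fromℕ (suc n) * f (suc n)

⊛-cong : ∀ {f f′ g g′} → f ≈ f′ → g ≈ g′ → f ⊛ g ≈ f′ ⊛ g′
⊛-cong f≈f′ g≈g′ n = Σ≤-cong n (λ i _ → cong₂ _*_ (f≈f′ i) (g≈g′ (n ∸ i)))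

⊛-congˡ : ∀ f {g g′} → g ≈ g′ → f ⊛ g ≈ f ⊛ g′
⊛-congˡ f = ⊛-cong {f} {f} (λ _ → refl)

⊛-comm : ∀ f g → f ⊛ g ≈ g ⊛ f
⊛-comm f g n = trans (Σ≤-reverse n _) (Σ≤-cong n (λ i i≤n →
  trans (cong (λ x → f (n ∸ i) * g x) (ℕₚ.m∸[m∸n]≡n i≤n)) (ℚₚ.*-comm (f (n ∸ i)) (g i))))

⊛-assoc : ∀ f g h → (f ⊛ g) ⊛ h ≈ f ⊛ (g ⊛ h)
⊛-assoc f g h n = begin
  Σ≤ n (λ i → Σ≤ i (λ a → f a * g (i ∸ a)) * h (n ∸ i))
    ≡⟨ Σ≤-cong n (λ i _ → *-distribʳ-Σ≤ i (h (n ∸ i)) _) ⟩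
  Σ≤ n (λ i → Σ≤ i (λ a → f a * g (i ∸ a) * h (n ∸ i)))
    ≡⟨ Σ≤-exchange n (λ a i → f a * g (i ∸ a) * h (n ∸ i)) ⟩
  Σ≤ n (λ a → Σ≤ (n ∸ a) (λ b → f a * g (a ℕ.+ b ∸ a) * h (n ∸ (a ℕ.+ b))))
    ≡⟨ Σ≤-cong n (λ a _ → trans (Σ≤-cong (n ∸ a) (λ b _ → reindex a b)) (sym (*-distribˡ-Σ≤ (n ∸ a) (f a) _))) ⟩
  Σ≤ n (λ a → f a * Σ≤ (n ∸ a) (λ b → g b * h (n ∸ a ∸ b))) ∎
  where
  open ≡-Reasoning
  reindex : ∀ a b → f a * g (a ℕ.+ b ∸ a) * h (n ∸ (a ℕ.+ b)) ≡ f a * (g b * h (n ∸ a ∸ b))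
  reindex a b = trans (cong₂ (λ x y → f a * g x * h y) (ℕₚ.m+n∸m≡n a b) (sym (ℕₚ.∸-+-assoc n a b)))
                      (ℚₚ.*-assoc (f a) (g b) (h (n ∸ a ∸ b)))

⊛-lcomm : ∀ f g h → f ⊛ (g ⊛ h) ≈ g ⊛ (f ⊛ h)
⊛-lcomm f g h = ≈-trans (≈-sym (⊛-assoc f g h))
  (≈-trans (⊛-cong {f ⊛ g} {g ⊛ f} {h} {h} (⊛-comm f g) (λ _ → refl)) (⊛-assoc g f h))

⊛-distribˡ-⊕ : ∀ f g h → f ⊛ (g ⊕ h) ≈ (f ⊛ g) ⊕ (f ⊛ h)
⊛-distribˡ-⊕ f g h n =
  trans (Σ≤-cong n (λ i _ → ℚₚ.*-distribˡ-+ (f i) (g (n ∸ i)) (h (n ∸ i)))) (Σ≤-+ n _ _)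

⊛-·S : ∀ f x g → f ⊛ (x ·S g) ≈ x ·S (f ⊛ g)
⊛-·S f x g n = trans
  (Σ≤-cong n (λ i _ → solve 3 (λ a b x → a :* (x :* b) := x :* (a :* b)) refl (f i) (g (n ∸ i)) x))
  (sym (*-distribˡ-Σ≤ n x _))

⊛-zeroʳ : ∀ f {g} → g ≈ 0S → f ⊛ g ≈ 0S
⊛-zeroʳ f g≈0 n = Σ≤-0 n (λ i _ → trans (cong (f i *_) (g≈0 (n ∸ i))) (ℚₚ.*-zeroʳ (f i)))

⊛-ΣS< : ∀ f c G → f ⊛ ΣS< c G ≈ ΣS< c (λ j → f ⊛ G j)
⊛-ΣS< f zero    G = ⊛-zeroʳ f (λ _ → refl)
⊛-ΣS< f (suc c) G n =
  trans (⊛-distribˡ-⊕ f (G 0) (ΣS< c (λ j → G (suc j))) n)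
        (cong ((f ⊛ G 0) n +_) (⊛-ΣS< f c (λ j → G (suc j)) n))

D-⊛ : ∀ f g → D (f ⊛ g) ≈ (D f ⊛ g) ⊕ (f ⊛ D g)
D-⊛ f g n = begin
  fromℕ (suc n) * Σ≤ (suc n) (λ i → f i * g (suc n ∸ i))
    ≡⟨ *-distribˡ-Σ≤ (suc n) (fromℕ (suc n)) _ ⟩
  Σ≤ (suc n) (λ i → fromℕ (suc n) * (f i * g (suc n ∸ i)))
    ≡⟨ Σ≤-cong (suc n) leibniz ⟩
  Σ≤ (suc n) (λ i → fromℕ i * f i * g (suc n ∸ i) + f i * (fromℕ (suc n ∸ i) * g (suc n ∸ i)))
    ≡⟨ Σ≤-+ (suc n) _ _ ⟩
  Σ≤ (suc n) (λ i → fromℕ i * f i * g (suc n ∸ i)) + Σ≤ (suc n) (λ i → f i * (fromℕ (suc n ∸ i) * g (suc n ∸ i)))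
    ≡⟨ cong₂ _+_ dropFirst dropLast ⟩
  (D f ⊛ g) n + (f ⊛ D g) n ∎
  where
  open ≡-Reasoning
  leibniz : ∀ i → i ≤ suc n →
    fromℕ (suc n) * (f i * g (suc n ∸ i)) ≡ fromℕ i * f i * g (suc n ∸ i) + f i * (fromℕ (suc n ∸ i) * g (suc n ∸ i))
  leibniz i i≤ = trans
    (cong (_* (f i * g (suc n ∸ i))) (trans (cong fromℕ (sym (ℕₚ.m+[n∸m]≡n i≤))) (fromℕ-+ i (suc n ∸ i))))
    (solve 4 (λ a b x y → (a :+ b) :* (x :* y) := a :* x :* y :+ x :* (b :* y)) refl
       (fromℕ i) (fromℕ (suc n ∸ i)) (f i) (g (suc n ∸ i)))
  dropFirst : Σ≤ (suc n) (λ i → fromℕ i * f i * g (suc n ∸ i)) ≡ (D f ⊛ g) n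
  dropFirst = begin
    Σ≤ (suc n) (λ i → fromℕ i * f i * g (suc n ∸ i))
      ≡⟨ Σ≤-suc-head n _ ⟩
    0ℚ * f 0 * g (suc n) + (D f ⊛ g) n
      ≡⟨ cong (λ x → x * g (suc n) + (D f ⊛ g) n) (ℚₚ.*-zeroˡ (f 0)) ⟩
    0ℚ * g (suc n) + (D f ⊛ g) n
      ≡⟨ cong (_+ (D f ⊛ g) n) (ℚₚ.*-zeroˡ (g (suc n))) ⟩
    0ℚ + (D f ⊛ g) n
      ≡⟨ ℚₚ.+-identityˡ _ ⟩
    (D f ⊛ g) n ∎
  dropLast : Σ≤ (suc n) (λ i → f i * (fromℕ (suc n ∸ i) * g (suc n ∸ i))) ≡ (f ⊛ D g) n
  dropLast = begin
    R + f (suc n) * (fromℕ (suc n ∸ suc n) * g (suc n ∸ suc n))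
      ≡⟨ cong (λ m → R + f (suc n) * (fromℕ m * g m)) (ℕₚ.n∸n≡0 n) ⟩
    R + f (suc n) * (0ℚ * g 0)
      ≡⟨ cong (λ x → R + f (suc n) * x) (ℚₚ.*-zeroˡ (g 0)) ⟩
    R + f (suc n) * 0ℚ
      ≡⟨ cong (R +_) (ℚₚ.*-zeroʳ (f (suc n))) ⟩
    R + 0ℚ
      ≡⟨ ℚₚ.+-identityʳ R ⟩
    R
      ≡⟨ Σ≤-cong n (λ i i≤n → cong (λ m → f i * (fromℕ m * g m)) (ℕₚ.+-∸-assoc 1 i≤n)) ⟩
    (f ⊛ D g) n ∎
    where
    R : ℚ
    R = Σ≤ n (λ i → f i * (fromℕ (suc n ∸ i) * g (suc n ∸ i)))

D-^S : ∀ y r → D (y ^S suc r) ≈ fromℕ (suc r) ·S (D y ⊛ (y ^S r))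
D-^S y zero n = begin
  D (y ⊛ oneS) n                      ≡⟨ D-⊛ y oneS n ⟩
  (D y ⊛ oneS) n + (y ⊛ D oneS) n     ≡⟨ cong ((D y ⊛ oneS) n +_) (⊛-zeroʳ y (λ m → ℚₚ.*-zeroʳ (fromℕ (suc m))) n) ⟩
  (D y ⊛ oneS) n + 0ℚ                 ≡⟨ ℚₚ.+-identityʳ _ ⟩
  (D y ⊛ oneS) n                      ≡⟨ ℚₚ.*-identityˡ _ ⟨
  1ℚ * (D y ⊛ oneS) n                 ∎
  where open ≡-Reasoning
D-^S y (suc r) n = begin
  D (y ⊛ (y ^S suc r)) n
    ≡⟨ D-⊛ y (y ^S suc r) n ⟩
  X + (y ⊛ D (y ^S suc r)) n
    ≡⟨ cong (X +_) (⊛-congˡ y (D-^S y r) n) ⟩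
  X + (y ⊛ (fromℕ (suc r) ·S (D y ⊛ (y ^S r)))) n
    ≡⟨ cong (X +_) (⊛-·S y (fromℕ (suc r)) (D y ⊛ (y ^S r)) n) ⟩
  X + fromℕ (suc r) * (y ⊛ (D y ⊛ (y ^S r))) n
    ≡⟨ cong (λ z → X + fromℕ (suc r) * z) (⊛-lcomm y (D y) (y ^S r) n) ⟩
  X + fromℕ (suc r) * X
    ≡⟨ solve 2 (λ x a → x :+ a :* x := (con 1ℚ :+ a) :* x) refl X (fromℕ (suc r)) ⟩
  (1ℚ + fromℕ (suc r)) * X
    ≡⟨ cong (_* X) (fromℕ-+ 1 (suc r)) ⟨
  fromℕ (suc (suc r)) * X ∎
  where
  open ≡-Reasoning
  X : ℚ
  X = (D y ⊛ (y ^S suc r)) n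

divPow : Series → ℕ → Series
divPow y r = invFact r ·S (y ^S r)

D-divPow-zero : ∀ y → D (divPow y 0) ≈ 0S
D-divPow-zero y n = trans (cong (fromℕ (suc n) *_) (ℚₚ.*-zeroʳ 1ℚ)) (ℚₚ.*-zeroʳ (fromℕ (suc n)))

D-divPow-suc : ∀ y r → D (divPow y (suc r)) ≈ D y ⊛ divPow y r
D-divPow-suc y r n = begin
  fromℕ (suc n) * (invFact (suc r) * (y ^S suc r) (suc n))
    ≡⟨ solve 3 (λ a b c → a :* (b :* c) := b :* (a :* c)) refl (fromℕ (suc n)) (invFact (suc r)) ((y ^S suc r) (suc n)) ⟩
  invFact (suc r) * D (y ^S suc r) n
    ≡⟨ cong (invFact (suc r) *_) (D-^S y r n) ⟩
  invFact (suc r) * (fromℕ (suc r) * (D y ⊛ (y ^S r)) n)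
    ≡⟨ solve 3 (λ a b c → a :* (b :* c) := (b :* a) :* c) refl (invFact (suc r)) (fromℕ (suc r)) ((D y ⊛ (y ^S r)) n) ⟩
  fromℕ (suc r) * invFact (suc r) * (D y ⊛ (y ^S r)) n
    ≡⟨ cong (_* (D y ⊛ (y ^S r)) n) (suc*invFact-suc r) ⟩
  invFact r * (D y ⊛ (y ^S r)) n
    ≡⟨ ⊛-·S (D y) (invFact r) (y ^S r) n ⟨
  (D y ⊛ divPow y r) n ∎
  where open ≡-Reasoning

divPow-suc-at0 : ∀ y r → y 0 ≡ 0ℚ → divPow y (suc r) 0 ≡ 0ℚ
divPow-suc-at0 y r y₀≡0 = trans (cong (λ x → invFact (suc r) * (x * (y ^S r) 0)) y₀≡0)
  (trans (cong (invFact (suc r) *_) (ℚₚ.*-zeroˡ ((y ^S r) 0))) (ℚₚ.*-zeroʳ (invFact (suc r))))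

n!*D : ∀ n (f : Series) → fromℕ (suc n !) * f (suc n) ≡ fromℕ (n !) * D f n
n!*D n f = trans (cong (_* f (suc n)) (fromℕ-* (suc n) (n !)))
  (solve 3 (λ a b x → a :* b :* x := b :* (a :* x)) refl (fromℕ (suc n)) (fromℕ (n !)) (f (suc n)))

-- Block growth series

indicator : Bool → ℚ
indicator b = if b then 1ℚ else 0ℚ

indicator-∧ : ∀ a b → indicator (a ∧ b) ≡ indicator a * indicator b
indicator-∧ true  b = sym (ℚₚ.*-identityˡ (indicator b))
indicator-∧ false b = sym (ℚₚ.*-zeroˡ (indicator b))

allᵇ-map : ∀ {A B : Set} (Q : B → Bool) (f : A → B) xs → allᵇ Q (map f xs) ≡ allᵇ (λ x → Q (f x)) xs
allᵇ-map Q f []       = refl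
allᵇ-map Q f (x ∷ xs) = cong (Q (f x) ∧_) (allᵇ-map Q f xs)

allᵇ-cong : ∀ {A : Set} {Q Q′ : A → Bool} xs → (∀ x → Q x ≡ Q′ x) → allᵇ Q xs ≡ allᵇ Q′ xs
allᵇ-cong []       Q≗Q′ = refl
allᵇ-cong (x ∷ xs) Q≗Q′ = cong₂ _∧_ (Q≗Q′ x) (allᵇ-cong xs Q≗Q′)

allFin-suc : ∀ c → allFin (suc c) ≡ Fin.zero ∷ map Fin.suc (allFin c)
allFin-suc c = cong (Fin.zero ∷_) (sym (List.map-tabulate (λ j → j) Fin.suc))

allᵇ-allFin-suc : ∀ c (Q : Fin (suc c) → Bool) →
  allᵇ Q (allFin (suc c)) ≡ Q Fin.zero ∧ allᵇ (λ j → Q (Fin.suc j)) (allFin c)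
allᵇ-allFin-suc c Q = trans (cong (allᵇ Q) (allFin-suc c)) (cong (Q Fin.zero ∧_) (allᵇ-map Q Fin.suc (allFin c)))

≡ᵇ-refl : ∀ n → (n ≡ᵇ n) ≡ true
≡ᵇ-refl n = Equivalence.to T-≡ (ℕₚ.≡⇒≡ᵇ n n refl)

≢⇒≡ᵇ-false : ∀ {m n} → m ≢ n → (m ≡ᵇ n) ≡ false
≢⇒≡ᵇ-false {m} {n} m≢n = ¬-not (λ m≡ᵇn → m≢n (ℕₚ.≡ᵇ⇒≡ m n (Equivalence.from T-≡ m≡ᵇn)))

<⇒<ᵇ-true : ∀ {m n} → m < n → (m <ᵇ n) ≡ true
<⇒<ᵇ-true m<n = Equivalence.to T-≡ (ℕₚ.<⇒<ᵇ m<n)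

≥⇒<ᵇ-false : ∀ {m n} → n ≤ m → (m <ᵇ n) ≡ false
≥⇒<ᵇ-false {m} {n} n≤m = ¬-not (λ m<ᵇn → ℕₚ.<⇒≱ (ℕₚ.<ᵇ⇒< m n (Equivalence.from T-≡ m<ᵇn)) n≤m)

bump : (ℕ → ℕ) → ℕ → ℕ → ℕ
bump s a j = if a ≡ᵇ j then suc (s j) else s j

bump-self : ∀ s j → bump s j j ≡ suc (s j)
bump-self s j rewrite ≡ᵇ-refl j = refl

bump-other : ∀ s {a j} → a ≢ j → bump s a j ≡ s j
bump-other s a≢j rewrite ≢⇒≡ᵇ-false a≢j = refl

module BlockSeries (P : ℕ → Bool) where

  -- grow s b counts, with weight 1/b!, the ways a block that already has s elements can receive b more.
  grow : ℕ → Series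
  grow s b = if P (s ℕ.+ b) then invFact b else 0ℚ

  blockSeries : Series
  blockSeries zero    = 0ℚ
  blockSeries (suc b) = grow 0 (suc b)

  D-grow : ∀ s → D (grow s) ≈ grow (suc s)
  D-grow s n rewrite ℕₚ.+-suc s n with P (suc (s ℕ.+ n))
  ... | true  = suc*invFact-suc n
  ... | false = ℚₚ.*-zeroʳ (fromℕ (suc n))

  D-blockSeries : D blockSeries ≈ grow 1
  D-blockSeries = D-grow 0

  openBlocks : ℕ → (ℕ → ℕ) → Series → Series
  openBlocks zero    s T = T
  openBlocks (suc c) s T = grow (s 0) ⊛ openBlocks c (λ j → s (suc j)) T

  openBlocks-cong : ∀ c s {T T′} → T ≈ T′ → openBlocks c s T ≈ openBlocks c s T′
  openBlocks-cong zero    s T≈T′ = T≈T′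
  openBlocks-cong (suc c) s T≈T′ = ⊛-congˡ (grow (s 0)) (openBlocks-cong c _ T≈T′)

  openBlocks-0S : ∀ c s {T} → T ≈ 0S → openBlocks c s T ≈ 0S
  openBlocks-0S zero    s T≈0 = T≈0
  openBlocks-0S (suc c) s T≈0 = ⊛-zeroʳ (grow (s 0)) (openBlocks-0S c _ T≈0)

  openBlocks-ext : ∀ c {s s′ : ℕ → ℕ} T → (∀ j → j < c → s j ≡ s′ j) → openBlocks c s T ≈ openBlocks c s′ T
  openBlocks-ext zero    T s≗s′ = λ _ → refl
  openBlocks-ext (suc c) {s} {s′} T s≗s′ n rewrite s≗s′ 0 (s≤s z≤n) =
    ⊛-congˡ (grow (s′ 0)) (openBlocks-ext c T (λ j j<c → s≗s′ (suc j) (s≤s j<c))) n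

  openBlocks-snoc : ∀ c s T → openBlocks c s (grow (s c) ⊛ T) ≈ openBlocks (suc c) s T
  openBlocks-snoc zero    s T = λ _ → refl
  openBlocks-snoc (suc c) s T = ⊛-congˡ (grow (s 0)) (openBlocks-snoc c _ T)

  openBlocks-at0 : ∀ c s T → openBlocks c s T 0 ≡ indicator (allᵇ (λ j → P (s (toℕ j) ℕ.+ 0)) (allFin c)) * T 0
  openBlocks-at0 zero    s T = sym (ℚₚ.*-identityˡ (T 0))
  openBlocks-at0 (suc c) s T = begin
    grow (s 0) 0 * openBlocks c (λ j → s (suc j)) T 0
      ≡⟨ cong (grow (s 0) 0 *_) (openBlocks-at0 c _ T) ⟩
    indicator (P (s 0 ℕ.+ 0)) * (indicator rest * T 0)
      ≡⟨ ℚₚ.*-assoc (indicator (P (s 0 ℕ.+ 0))) (indicator rest) (T 0) ⟨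
    indicator (P (s 0 ℕ.+ 0)) * indicator rest * T 0
      ≡⟨ cong (_* T 0) (indicator-∧ (P (s 0 ℕ.+ 0)) rest) ⟨
    indicator (P (s 0 ℕ.+ 0) ∧ rest) * T 0
      ≡⟨ cong (λ b → indicator b * T 0) (allᵇ-allFin-suc c (λ j → P (s (toℕ j) ℕ.+ 0))) ⟨
    indicator (allᵇ (λ j → P (s (toℕ j) ℕ.+ 0)) (allFin (suc c))) * T 0 ∎
    where
    open ≡-Reasoning
    rest : Bool
    rest = allᵇ (λ j → P (s (suc (toℕ j)) ℕ.+ 0)) (allFin c)

  -- Leibniz rule: differentiating the factor of block j is the same as bumping its size.
  D-openBlocks : ∀ c s T → D (openBlocks c s T) ≈ ΣS< c (λ j → openBlocks c (bump s j) T) ⊕ openBlocks c s (D T)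
  D-openBlocks zero    s T n = sym (ℚₚ.+-identityˡ (D T n))
  D-openBlocks (suc c) s T n = begin
    D (g ⊛ X) n
      ≡⟨ D-⊛ g X n ⟩
    (D g ⊛ X) n + (g ⊛ D X) n
      ≡⟨ cong₂ _+_ (⊛-cong {g = X} (D-grow (s 0)) (λ _ → refl) n) (⊛-congˡ g {D X} (D-openBlocks c s′ T) n) ⟩
    (grow (suc (s 0)) ⊛ X) n + (g ⊛ (ΣS< c (λ j → openBlocks c (bump s′ j) T) ⊕ openBlocks c s′ (D T))) n
      ≡⟨ cong ((grow (suc (s 0)) ⊛ X) n +_) (⊛-distribˡ-⊕ g (ΣS< c (λ j → openBlocks c (bump s′ j) T)) (openBlocks c s′ (D T)) n) ⟩
    (grow (suc (s 0)) ⊛ X) n + ((g ⊛ ΣS< c (λ j → openBlocks c (bump s′ j) T)) n + (g ⊛ openBlocks c s′ (D T)) n)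
      ≡⟨ cong (λ z → (grow (suc (s 0)) ⊛ X) n + (z + (g ⊛ openBlocks c s′ (D T)) n))
              (⊛-ΣS< g c (λ j → openBlocks c (bump s′ j) T) n) ⟩
    (grow (suc (s 0)) ⊛ X) n + (ΣS< c (λ j → g ⊛ openBlocks c (bump s′ j) T) n + (g ⊛ openBlocks c s′ (D T)) n)
      ≡⟨ ℚₚ.+-assoc ((grow (suc (s 0)) ⊛ X) n) (ΣS< c (λ j → g ⊛ openBlocks c (bump s′ j) T) n) _ ⟨
    ΣS< (suc c) (λ j → openBlocks (suc c) (bump s j) T) n + openBlocks (suc c) s (D T) n ∎
    where
    open ≡-Reasoning
    s′ : ℕ → ℕ
    s′ j = s (suc j)
    g : Series
    g = grow (s 0)
    X : Series
    X = openBlocks c s′ T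

  openBlocks-complete-at0 : ∀ c s →
    openBlocks c s (divPow blockSeries 0) 0 ≡ indicator (allᵇ (λ j → P (s (toℕ j) ℕ.+ 0)) (allFin c))
  openBlocks-complete-at0 c s = trans (openBlocks-at0 c s _)
    (trans (cong (indicator (allᵇ (λ j → P (s (toℕ j) ℕ.+ 0)) (allFin c)) *_) (ℚₚ.*-identityˡ 1ℚ))
           (ℚₚ.*-identityʳ _))

  openBlocks-incomplete-at0 : ∀ c s r → openBlocks c s (divPow blockSeries (suc r)) 0 ≡ 0ℚ
  openBlocks-incomplete-at0 c s r = trans (openBlocks-at0 c s _)
    (trans (cong (indicator (allᵇ (λ j → P (s (toℕ j) ℕ.+ 0)) (allFin c)) *_) (divPow-suc-at0 blockSeries r refl))
           (ℚₚ.*-zeroʳ (indicator (allᵇ (λ j → P (s (toℕ j) ℕ.+ 0)) (allFin c)))))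

  D-openBlocks-complete : ∀ c s →
    D (openBlocks c s (divPow blockSeries 0)) ≈ ΣS< c (λ j → openBlocks c (bump s j) (divPow blockSeries 0))
  D-openBlocks-complete c s n = trans (D-openBlocks c s _ n)
    (trans (cong (ΣS< c (λ j → openBlocks c (bump s j) (divPow blockSeries 0)) n +_)
                 (openBlocks-0S c s (D-divPow-zero blockSeries) n))
           (ℚₚ.+-identityʳ _))

  D-openBlocks-incomplete : ∀ c s r → s c ≡ 0 →
    D (openBlocks c s (divPow blockSeries (suc r)))
      ≈ ΣS< c (λ j → openBlocks c (bump s j) (divPow blockSeries (suc r)))
        ⊕ openBlocks (suc c) (bump s c) (divPow blockSeries r)
  D-openBlocks-incomplete c s r sc≡0 n =
    trans (D-openBlocks c s _ n) (cong (ΣS< c (λ j → openBlocks c (bump s j) (divPow y (suc r))) n +_) openNewBlock)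
    where
    open ≡-Reasoning
    y : Series
    y = blockSeries
    openNewBlock : openBlocks c s (D (divPow y (suc r))) n ≡ openBlocks (suc c) (bump s c) (divPow y r) n
    openNewBlock = begin
      openBlocks c s (D (divPow y (suc r))) n
        ≡⟨ openBlocks-cong c s (D-divPow-suc y r) n ⟩
      openBlocks c s (D y ⊛ divPow y r) n
        ≡⟨ openBlocks-cong c s (⊛-cong {g = divPow y r} D-blockSeries (λ _ → refl)) n ⟩
      openBlocks c s (grow 1 ⊛ divPow y r) n
        ≡⟨ cong (λ m → openBlocks c s (grow m ⊛ divPow y r) n) (trans (cong suc (sym sc≡0)) (sym (bump-self s c))) ⟩
      openBlocks c s (grow (bump s c c) ⊛ divPow y r) n
        ≡⟨ openBlocks-ext c _ (λ j j<c → sym (bump-other s (ℕₚ.>⇒≢ j<c))) n ⟩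
      openBlocks c (bump s c) (grow (bump s c c) ⊛ divPow y r) n
        ≡⟨ openBlocks-snoc c (bump s c) (divPow y r) n ⟩
      openBlocks (suc c) (bump s c) (divPow y r) n ∎

-- Counting restricted growth strings

fromℕ-sum-allFin : ∀ c (g : ℕ → ℕ) → fromℕ (sum (map (λ j → g (toℕ j)) (allFin c))) ≡ Σ< c (λ j → fromℕ (g j))
fromℕ-sum-allFin zero    g = refl
fromℕ-sum-allFin (suc c) g = begin
  fromℕ (sum (map (λ j → g (toℕ j)) (allFin (suc c))))
    ≡⟨ cong (λ js → fromℕ (sum (map (λ j → g (toℕ j)) js))) (allFin-suc c) ⟩
  fromℕ (g 0 ℕ.+ sum (map (λ j → g (toℕ j)) (map Fin.suc (allFin c))))
    ≡⟨ cong (λ xs → fromℕ (g 0 ℕ.+ sum xs)) (List.map-∘ (allFin c)) ⟨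
  fromℕ (g 0 ℕ.+ sum (map (λ j → g (suc (toℕ j))) (allFin c)))
    ≡⟨ fromℕ-+ (g 0) _ ⟩
  fromℕ (g 0) + fromℕ (sum (map (λ j → g (suc (toℕ j))) (allFin c)))
    ≡⟨ cong (fromℕ (g 0) +_) (fromℕ-sum-allFin c (λ j → g (suc j))) ⟩
  Σ< (suc c) (λ j → fromℕ (g j)) ∎
  where open ≡-Reasoning

countᵇ-cong : ∀ {A : Set} {Q Q′ : A → Bool} xs → (∀ x → Q x ≡ Q′ x) → countᵇ Q xs ≡ countᵇ Q′ xs
countᵇ-cong []       Q≗Q′ = refl
countᵇ-cong (x ∷ xs) Q≗Q′ = cong₂ ℕ._+_ (cong (λ b → if b then 1 else 0) (Q≗Q′ x)) (countᵇ-cong xs Q≗Q′)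

countᵇ-false : ∀ {A : Set} (xs : List A) → countᵇ (λ _ → false) xs ≡ 0
countᵇ-false []       = refl
countᵇ-false (x ∷ xs) = countᵇ-false xs

countᵇ-++ : ∀ {A : Set} (Q : A → Bool) xs ys → countᵇ Q (xs ++ ys) ≡ countᵇ Q xs ℕ.+ countᵇ Q ys
countᵇ-++ Q []       ys = refl
countᵇ-++ Q (x ∷ xs) ys =
  trans (cong ((if Q x then 1 else 0) ℕ.+_) (countᵇ-++ Q xs ys)) (sym (ℕₚ.+-assoc (if Q x then 1 else 0) _ _))

countᵇ-map : ∀ {A B : Set} (Q : B → Bool) (f : A → B) xs → countᵇ Q (map f xs) ≡ countᵇ (λ x → Q (f x)) xs
countᵇ-map Q f []       = refl
countᵇ-map Q f (x ∷ xs) = cong ((if Q (f x) then 1 else 0) ℕ.+_) (countᵇ-map Q f xs)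

countᵇ-concatMap : ∀ {A B : Set} (Q : B → Bool) (F : A → List B) xs →
  countᵇ Q (concatMap F xs) ≡ sum (map (λ x → countᵇ Q (F x)) xs)
countᵇ-concatMap Q F []       = refl
countᵇ-concatMap Q F (x ∷ xs) =
  trans (countᵇ-++ Q (F x) (concatMap F xs)) (cong (countᵇ Q (F x) ℕ.+_) (countᵇ-concatMap Q F xs))

canonicalFrom-∷ : ∀ {k n} c (x : Fin k) (w : Vec (Fin k) n) →
  canonicalFrom c (x ∷ w) ≡ (if toℕ x ≡ᵇ c then canonicalFrom (suc c) w else (toℕ x <ᵇ c) ∧ canonicalFrom c w)
canonicalFrom-∷ c x w with toℕ x ≡ᵇ c
... | true  = refl
... | false = refl

bump-+ : ∀ s a j b → s j ℕ.+ ((if a ≡ᵇ j then 1 else 0) ℕ.+ b) ≡ bump s a j ℕ.+ b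
bump-+ s a j b with a ≡ᵇ j
... | true  = ℕₚ.+-suc (s j) b
... | false = refl

module Completions (P : ℕ → Bool) (k : ℕ) where
  open BlockSeries P

  -- w is a valid tail of a restricted growth string that has so far used the labels 0,…,c-1 and put s j elements into block j.
  Admissible : ∀ {n} → ℕ → (ℕ → ℕ) → Vec (Fin k) n → Bool
  Admissible c s w = canonicalFrom c w ∧ allᵇ (λ j → P (s (toℕ j) ℕ.+ blockSize j w)) (allFin k)

  completions : ℕ → ℕ → (ℕ → ℕ) → ℕ
  completions n c s = countᵇ (Admissible c s) (words k n)

  byFirstLetter : ℕ → ℕ → (ℕ → ℕ) → ℕ → ℕ
  byFirstLetter n c s j =
    if j ≡ᵇ c then completions n (suc c) (bump s j) else if j <ᵇ c then completions n c (bump s j) else 0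

  completions-∷ : ∀ n c s (x : Fin k) →
    countᵇ (λ w → Admissible c s (x ∷ w)) (words k n) ≡ byFirstLetter n c s (toℕ x)
  completions-∷ n c s x =
    trans (countᵇ-cong (words k n) (λ w → cong₂ _∧_ (canonicalFrom-∷ c x w) (bumped w)))
          (byCase (toℕ x ≡ᵇ c) (toℕ x <ᵇ c))
    where
    Bumped : Vec (Fin k) n → Bool
    Bumped w = allᵇ (λ j → P (bump s (toℕ x) (toℕ j) ℕ.+ blockSize j w)) (allFin k)
    bumped : ∀ w → allᵇ (λ j → P (s (toℕ j) ℕ.+ blockSize j (x ∷ w))) (allFin k) ≡ Bumped w
    bumped w = allᵇ-cong (allFin k) (λ j → cong P (bump-+ s (toℕ x) (toℕ j) (blockSize j w)))
    byCase : ∀ new old →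
      countᵇ (λ w → (if new then canonicalFrom (suc c) w else old ∧ canonicalFrom c w) ∧ Bumped w) (words k n)
        ≡ (if new then completions n (suc c) (bump s (toℕ x)) else if old then completions n c (bump s (toℕ x)) else 0)
    byCase true  _     = refl
    byCase false true  = refl
    byCase false false = countᵇ-false (words k n)

  completions-suc : ∀ n c s → fromℕ (completions (suc n) c s) ≡ Σ< k (λ j → fromℕ (byFirstLetter n c s j))
  completions-suc n c s = begin
    fromℕ (countᵇ (Admissible c s) (concatMap (λ x → map (x ∷_) (words k n)) (allFin k)))
      ≡⟨ cong fromℕ (countᵇ-concatMap (Admissible c s) _ (allFin k)) ⟩
    fromℕ (sum (map (λ x → countᵇ (Admissible c s) (map (x ∷_) (words k n))) (allFin k)))
      ≡⟨ cong (λ xs → fromℕ (sum xs)) (List.map-cong byFirst (allFin k)) ⟩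
    fromℕ (sum (map (λ x → byFirstLetter n c s (toℕ x)) (allFin k)))
      ≡⟨ fromℕ-sum-allFin k (byFirstLetter n c s) ⟩
    Σ< k (λ j → fromℕ (byFirstLetter n c s j)) ∎
    where
    open ≡-Reasoning
    byFirst : ∀ x → countᵇ (Admissible c s) (map (x ∷_) (words k n)) ≡ byFirstLetter n c s (toℕ x)
    byFirst x = trans (countᵇ-map (Admissible c s) (x ∷_) (words k n)) (completions-∷ n c s x)

  byFirstLetter-old : ∀ n c s {j} → j < c → byFirstLetter n c s j ≡ completions n c (bump s j)
  byFirstLetter-old n c s j<c rewrite ≢⇒≡ᵇ-false (ℕₚ.<⇒≢ j<c) | <⇒<ᵇ-true j<c = refl

  byFirstLetter-new : ∀ n c s → byFirstLetter n c s c ≡ completions n (suc c) (bump s c)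
  byFirstLetter-new n c s rewrite ≡ᵇ-refl c = refl

  byFirstLetter-skip : ∀ n c s {j} → c < j → byFirstLetter n c s j ≡ 0
  byFirstLetter-skip n c s c<j rewrite ≢⇒≡ᵇ-false (ℕₚ.>⇒≢ c<j) | ≥⇒<ᵇ-false (ℕₚ.<⇒≤ c<j) = refl

  completions-suc-complete : ∀ n s → fromℕ (completions (suc n) k s) ≡ Σ< k (λ j → fromℕ (completions n k (bump s j)))
  completions-suc-complete n s =
    trans (completions-suc n k s) (Σ<-cong k (λ j j<k → cong fromℕ (byFirstLetter-old n k s j<k)))

  completions-suc-incomplete : ∀ n c s → c < k →
    fromℕ (completions (suc n) c s)
      ≡ Σ< c (λ j → fromℕ (completions n c (bump s j))) + fromℕ (completions n (suc c) (bump s c))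
  completions-suc-incomplete n c s c<k = begin
    fromℕ (completions (suc n) c s)
      ≡⟨ completions-suc n c s ⟩
    Σ< k first
      ≡⟨ Σ<-truncate (suc c) k first c<k (λ j c<j _ → cong fromℕ (byFirstLetter-skip n c s c<j)) ⟩
    Σ< (suc c) first
      ≡⟨ Σ<-suc-last c first ⟩
    Σ< c first + first c
      ≡⟨ cong₂ _+_ (Σ<-cong c (λ j j<c → cong fromℕ (byFirstLetter-old n c s j<c)))
                   (cong fromℕ (byFirstLetter-new n c s)) ⟩
    Σ< c (λ j → fromℕ (completions n c (bump s j))) + fromℕ (completions n (suc c) (bump s c)) ∎
    where
    open ≡-Reasoning
    first : ℕ → ℚ
    first j = fromℕ (byFirstLetter n c s j)

  completions-zero-complete : ∀ s →
    fromℕ (completions 0 k s) ≡ indicator (allᵇ (λ j → P (s (toℕ j) ℕ.+ 0)) (allFin k))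
  completions-zero-complete s rewrite ≡ᵇ-refl k with allᵇ (λ j → P (s (toℕ j) ℕ.+ 0)) (allFin k)
  ... | true  = refl
  ... | false = refl

  completions-zero-incomplete : ∀ c s → c < k → completions 0 c s ≡ 0
  completions-zero-incomplete c s c<k rewrite ≢⇒≡ᵇ-false (ℕₚ.<⇒≢ c<k) = refl

  EmptyFrom : ℕ → (ℕ → ℕ) → Set
  EmptyFrom c s = ∀ j → c ≤ j → s j ≡ 0

  EmptyFrom-bump-old : ∀ {c s j} → EmptyFrom c s → j < c → EmptyFrom c (bump s j)
  EmptyFrom-bump-old {s = s} empty j<c i c≤i =
    trans (bump-other s (λ j≡i → ℕₚ.<⇒≱ j<c (subst (_ ≤_) (sym j≡i) c≤i))) (empty i c≤i)

  EmptyFrom-bump-new : ∀ {c s} → EmptyFrom c s → EmptyFrom (suc c) (bump s c)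
  EmptyFrom-bump-new {s = s} empty i c<i = trans (bump-other s (ℕₚ.<⇒≢ c<i)) (empty i (ℕₚ.<⇒≤ c<i))

  Expansion : ℕ → ℕ → ℕ → (ℕ → ℕ) → Set
  Expansion n r c s = fromℕ (completions n c s) ≡ fromℕ (n !) * openBlocks c s (divPow blockSeries r) n

  +-suc≡⇒< : ∀ {c r} → c ℕ.+ suc r ≡ k → c < k
  +-suc≡⇒< {c} c+r≡k = subst (c <_) c+r≡k (ℕₚ.m<m+n c ℕ.z<s)

  expansion-zero : ∀ r c s → c ℕ.+ r ≡ k → Expansion 0 r c s
  expansion-zero zero c s c+0≡k with trans (sym (ℕₚ.+-identityʳ c)) c+0≡k
  ... | refl = trans (completions-zero-complete s)
    (trans (sym (openBlocks-complete-at0 c s)) (sym (ℚₚ.*-identityˡ _)))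
  expansion-zero (suc r) c s c+r≡k = begin
    fromℕ (completions 0 c s)
      ≡⟨ cong fromℕ (completions-zero-incomplete c s (+-suc≡⇒< c+r≡k)) ⟩
    0ℚ
      ≡⟨ ℚₚ.*-zeroʳ 1ℚ ⟨
    1ℚ * 0ℚ
      ≡⟨ cong (1ℚ *_) (openBlocks-incomplete-at0 c s r) ⟨
    fromℕ (0 !) * openBlocks c s (divPow blockSeries (suc r)) 0 ∎
    where open ≡-Reasoning

  expansion-suc : ∀ n r c s → c ℕ.+ r ≡ k → EmptyFrom c s →
    (∀ r′ c′ s′ → c′ ℕ.+ r′ ≡ k → EmptyFrom c′ s′ → Expansion n r′ c′ s′) → Expansion (suc n) r c s
  expansion-suc n zero c s c+0≡k empty IH with trans (sym (ℕₚ.+-identityʳ c)) c+0≡k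
  ... | refl = begin
    fromℕ (completions (suc n) c s)
      ≡⟨ completions-suc-complete n s ⟩
    Σ< c (λ j → fromℕ (completions n c (bump s j)))
      ≡⟨ Σ<-cong c (λ j j<c → IH 0 c (bump s j) c+0≡k (EmptyFrom-bump-old empty j<c)) ⟩
    Σ< c (λ j → fromℕ (n !) * openBlocks c (bump s j) Y₀ n)
      ≡⟨ *-distribˡ-Σ< c (fromℕ (n !)) _ ⟨
    fromℕ (n !) * ΣS< c (λ j → openBlocks c (bump s j) Y₀) n
      ≡⟨ cong (fromℕ (n !) *_) (D-openBlocks-complete c s n) ⟨
    fromℕ (n !) * D (openBlocks c s Y₀) n
      ≡⟨ n!*D n (openBlocks c s Y₀) ⟨
    fromℕ (suc n !) * openBlocks c s Y₀ (suc n) ∎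
    where
    open ≡-Reasoning
    Y₀ : Series
    Y₀ = divPow blockSeries 0
  expansion-suc n (suc r) c s c+r≡k empty IH = begin
    fromℕ (completions (suc n) c s)
      ≡⟨ completions-suc-incomplete n c s (+-suc≡⇒< c+r≡k) ⟩
    Σ< c (λ j → fromℕ (completions n c (bump s j))) + fromℕ (completions n (suc c) (bump s c))
      ≡⟨ cong₂ _+_ (Σ<-cong c (λ j j<c → IH (suc r) c (bump s j) c+r≡k (EmptyFrom-bump-old empty j<c)))
                   (IH r (suc c) (bump s c) (trans (sym (ℕₚ.+-suc c r)) c+r≡k) (EmptyFrom-bump-new empty)) ⟩
    Σ< c (λ j → fromℕ (n !) * openBlocks c (bump s j) Y n) + fromℕ (n !) * openBlocks (suc c) (bump s c) Y′ n
      ≡⟨ cong (_+ fromℕ (n !) * openBlocks (suc c) (bump s c) Y′ n) (*-distribˡ-Σ< c (fromℕ (n !)) _) ⟨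
    fromℕ (n !) * ΣS< c (λ j → openBlocks c (bump s j) Y) n + fromℕ (n !) * openBlocks (suc c) (bump s c) Y′ n
      ≡⟨ ℚₚ.*-distribˡ-+ (fromℕ (n !)) _ _ ⟨
    fromℕ (n !) * (ΣS< c (λ j → openBlocks c (bump s j) Y) ⊕ openBlocks (suc c) (bump s c) Y′) n
      ≡⟨ cong (fromℕ (n !) *_) (D-openBlocks-incomplete c s r (empty c ℕₚ.≤-refl) n) ⟨
    fromℕ (n !) * D (openBlocks c s Y) n
      ≡⟨ n!*D n (openBlocks c s Y) ⟨
    fromℕ (suc n !) * openBlocks c s Y (suc n) ∎
    where
    open ≡-Reasoning
    Y Y′ : Series
    Y  = divPow blockSeries (suc r)
    Y′ = divPow blockSeries r

  expansion : ∀ n r c s → c ℕ.+ r ≡ k → EmptyFrom c s → Expansion n r c s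
  expansion zero    r c s c+r≡k _     = expansion-zero r c s c+r≡k
  expansion (suc n) r c s c+r≡k empty = expansion-suc n r c s c+r≡k empty (expansion n)

  partitions-expansion : ∀ n →
    fromℕ (countᵇ (λ w → canonical w ∧ allBlocks P w) (words k n)) ≡ fromℕ (n !) * divPow blockSeries k n
  partitions-expansion n = expansion n k 0 (λ _ → 0) refl (λ _ _ → refl)

sgn-+ : ∀ a b → sgn (a ℕ.+ b) ≡ sgn a * sgn b
sgn-+ zero    b = sym (ℚₚ.*-identityˡ (sgn b))
sgn-+ (suc a) b = trans (cong -_ (sgn-+ a b)) (ℚₚ.neg-distribˡ-* (sgn a) (sgn b))

sgn*sgn : ∀ a → sgn a * sgn a ≡ 1ℚ
sgn*sgn zero    = refl
sgn*sgn (suc a) = trans (solve 1 (λ x → (:- x) :* (:- x) := x :* x) refl (sgn a)) (sgn*sgn a)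

sgn-+≡sgn-∸ : ∀ n k → k ≤ n → sgn (n ℕ.+ k) ≡ sgn (n ∸ k)
sgn-+≡sgn-∸ n k k≤n = begin
  sgn (n ℕ.+ k)                       ≡⟨ cong (λ x → sgn (x ℕ.+ k)) (ℕₚ.m∸n+n≡m k≤n) ⟨
  sgn (n ∸ k ℕ.+ k ℕ.+ k)             ≡⟨ cong sgn (ℕₚ.+-assoc (n ∸ k) k k) ⟩
  sgn (n ∸ k ℕ.+ (k ℕ.+ k))           ≡⟨ sgn-+ (n ∸ k) (k ℕ.+ k) ⟩
  sgn (n ∸ k) * sgn (k ℕ.+ k)         ≡⟨ cong (sgn (n ∸ k) *_) (trans (sgn-+ k k) (sgn*sgn k)) ⟩
  sgn (n ∸ k) * 1ℚ                    ≡⟨ ℚₚ.*-identityʳ _ ⟩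
  sgn (n ∸ k)                         ∎
  where open ≡-Reasoning

-- The hypothesis on z says z(t) = -y(-t).
^S-sign : ∀ (y z : Series) → (∀ j → z j ≡ sgn (suc j) * y j) → ∀ k n → (z ^S k) n ≡ sgn (n ℕ.+ k) * (y ^S k) n
^S-sign y z z≡-y[-t] zero    zero    = sym (ℚₚ.*-identityˡ 1ℚ)
^S-sign y z z≡-y[-t] zero    (suc n) = sym (ℚₚ.*-zeroʳ (sgn (suc n ℕ.+ 0)))
^S-sign y z z≡-y[-t] (suc k) n =
  trans (Σ≤-cong n term) (sym (*-distribˡ-Σ≤ n (sgn (n ℕ.+ suc k)) _))
  where
  term : ∀ i → i ≤ n → z i * (z ^S k) (n ∸ i) ≡ sgn (n ℕ.+ suc k) * (y i * (y ^S k) (n ∸ i))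
  term i i≤n = begin
    z i * (z ^S k) (n ∸ i)
      ≡⟨ cong₂ _*_ (z≡-y[-t] i) (^S-sign y z z≡-y[-t] k (n ∸ i)) ⟩
    sgn (suc i) * y i * (sgn (n ∸ i ℕ.+ k) * (y ^S k) (n ∸ i))
      ≡⟨ solve 4 (λ a b c d → a :* b :* (c :* d) := (a :* c) :* (b :* d)) refl
           (sgn (suc i)) (y i) (sgn (n ∸ i ℕ.+ k)) ((y ^S k) (n ∸ i)) ⟩
    sgn (suc i) * sgn (n ∸ i ℕ.+ k) * (y i * (y ^S k) (n ∸ i))
      ≡⟨ cong (_* (y i * (y ^S k) (n ∸ i))) (trans (sym (sgn-+ (suc i) (n ∸ i ℕ.+ k))) (cong sgn exponent)) ⟩
    sgn (n ℕ.+ suc k) * (y i * (y ^S k) (n ∸ i)) ∎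
    where
    open ≡-Reasoning
    exponent : suc i ℕ.+ (n ∸ i ℕ.+ k) ≡ n ℕ.+ suc k
    exponent = trans (cong suc (trans (sym (ℕₚ.+-assoc i (n ∸ i) k)) (cong (ℕ._+ k) (ℕₚ.m+[n∸m]≡n i≤n))))
                     (sym (ℕₚ.+-suc n k))

egf-polyB≡LiOver : ∀ (S : ℕ → ℕ → ℕ) (y z : Series) →
  (∀ n k → fromℕ (S n k) ≡ fromℕ (n !) * divPow y k n) → (∀ j → z j ≡ sgn (suc j) * y j) →
  ∀ μ n → egf (polyB S μ) n ≡ LiOver μ z n
egf-polyB≡LiOver S y z S≡n!y^k/k! z≡-y[-t] μ n = trans (*-distribʳ-Σ≤ n (invFact n) _) (Σ≤-cong n term)
  where
  term : ∀ k → k ≤ n → sgn (n ∸ k) * (fromℕ (k ! ℕ.* S n k) * invPow k μ) * invFact n ≡ (z ^S k) n * invPow k μ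
  term k k≤n = begin
    sgn (n ∸ k) * (fromℕ (k ! ℕ.* S n k) * invPow k μ) * invFact n
      ≡⟨ cong (λ x → sgn (n ∸ k) * (x * invPow k μ) * invFact n)
              (trans (fromℕ-* (k !) (S n k)) (cong (fromℕ (k !) *_) (S≡n!y^k/k! n k))) ⟩
    sgn (n ∸ k) * (fromℕ (k !) * (fromℕ (n !) * (invFact k * yᵏ)) * invPow k μ) * invFact n
      ≡⟨ solve 7 (λ σ a b c d u v → σ :* (a :* (b :* (c :* u)) :* v) :* d := σ :* u :* v :* ((a :* c) :* (b :* d))) refl
           (sgn (n ∸ k)) (fromℕ (k !)) (fromℕ (n !)) (invFact k) (invFact n) yᵏ (invPow k μ) ⟩
    sgn (n ∸ k) * yᵏ * invPow k μ * ((fromℕ (k !) * invFact k) * (fromℕ (n !) * invFact n))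
      ≡⟨ cong₂ (λ a b → sgn (n ∸ k) * yᵏ * invPow k μ * (a * b)) (n!*invFact≡1 k) (n!*invFact≡1 n) ⟩
    sgn (n ∸ k) * yᵏ * invPow k μ * (1ℚ * 1ℚ)
      ≡⟨ ℚₚ.*-identityʳ _ ⟩
    sgn (n ∸ k) * yᵏ * invPow k μ
      ≡⟨ cong (λ σ → σ * yᵏ * invPow k μ) (sgn-+≡sgn-∸ n k k≤n) ⟨
    sgn (n ℕ.+ k) * yᵏ * invPow k μ
      ≡⟨ cong (_* invPow k μ) (^S-sign y z z≡-y[-t] k n) ⟨
    (z ^S k) n * invPow k μ ∎
    where
    open ≡-Reasoning
    yᵏ : ℚ
    yᵏ = (y ^S k) n

1-E[-t]≡-y≤[-t] : ∀ m j → (oneS ⊝ negArg (E m)) j ≡ sgn (suc j) * BlockSeries.blockSeries (_≤ᵇ m) j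
1-E[-t]≡-y≤[-t] m zero    = refl
1-E[-t]≡-y≤[-t] m (suc j) = solve 2 (λ σ x → con 0ℚ :- (:- σ) :* x := (:- (:- σ)) :* x) refl
  (sgn j) (if suc j ≤ᵇ m then invFact (suc j) else 0ℚ)

E[-t]-e⁻ᵗ≡-y≥[-t] : ∀ m j → (negArg (E m) ⊝ negArg expS) j ≡ sgn (suc j) * BlockSeries.blockSeries (suc m ≤ᵇ_) j
E[-t]-e⁻ᵗ≡-y≥[-t] m zero = refl
E[-t]-e⁻ᵗ≡-y≥[-t] m (suc j) with ℕₚ.<-≤-connex j m
... | inj₁ j<m rewrite <⇒<ᵇ-true j<m | ≥⇒<ᵇ-false {m} {suc j} j<m =
  solve 2 (λ σ x → (:- σ) :* x :- (:- σ) :* x := (:- (:- σ)) :* con 0ℚ) refl (sgn j) (invFact (suc j))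
... | inj₂ m≤j rewrite ≥⇒<ᵇ-false {j} {m} m≤j | <⇒<ᵇ-true {m} {suc j} (s≤s m≤j) =
  solve 2 (λ σ x → (:- σ) :* con 0ℚ :- (:- σ) :* x := (:- (:- σ)) :* x) refl (sgn j) (invFact (suc j))

theorem1 : (μ m : ℕ) → 1 ≤ μ → 1 ≤ m →
    ((n : ℕ) → egf (B≤ μ m) n ≡ LiOver μ (oneS ⊝ negArg (E m)) n)
    × ((n : ℕ) → egf (B≥ μ m) n ≡ LiOver μ (negArg (E (m ∸ 1)) ⊝ negArg expS) n)
theorem1 μ (suc m) _ _ =
  egf-polyB≡LiOver (S≤ (suc m)) _ _ (λ n k → Completions.partitions-expansion (_≤ᵇ suc m) k n) (1-E[-t]≡-y≤[-t] (suc m)) μ ,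
  egf-polyB≡LiOver (S≥ (suc m)) _ _ (λ n k → Completions.partitions-expansion (suc m ≤ᵇ_) k n) (E[-t]-e⁻ᵗ≡-y≥[-t] m) μ
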